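{- Let $T$ be a tree and $S \subseteq V(T)$ such that $|N[v] \cap S| \ge 2$ for every $v \in V(T)$. Then $S$ is a RED:LD set of $T$.
   Context: $N(v)$ denotes the open neighborhood of $v$ and $N[v]=N(v)\cup\{v\}$. A set $S \subseteq V(G)$ is a locating-dominating (LD) set if for all $u,v \in V(G)-S$: $N(v)\cap S \neq \varnothing$, and if $u \ne v$ then $N(v) \cap S \neq N(u) \cap S$. A RED:LD set is an LD set $S$ such that $S-\{v\}$ is an LD set for every $v \in S$. -}

module Defs where

open import Data.Nat using (ℕ; suc; _≥_)
open import Data.Fin using (Fin)
open import Data.Fin.Subset using (Subset; _∈_; _∉_; ⁅_⁆; _─_)
open import Data.List using (List; []; _∷_; length)
open import Data.List.Relation.Unary.Unique.Propositional using (Unique)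
open import Data.Product using (_×_; Σ; ∃; ∃-syntax; _,_)
open import Data.Sum using (_⊎_)
open import Relation.Nullary using (¬_; Dec)
open import Relation.Binary.PropositionalEquality using (_≡_)
open import Function.Bundles using (_⇔_)

record SimpleGraph (n : ℕ) : Set₁ where
  field
    Adj     : Fin n → Fin n → Set
    adj-dec : ∀ u v → Dec (Adj u v)
    irrefl  : ∀ v → ¬ Adj v v
    sym     : ∀ {u v} → Adj u v → Adj v u
open SimpleGraph public

module _ {n : ℕ} (G : SimpleGraph n) where

  data Chain : List (Fin n) → Set where
    chain-[] : Chain []
    chain-1  : ∀ v → Chain (v ∷ [])
    chain-∷  : ∀ {u v vs} → Adj G u v → Chain (v ∷ vs) → Chain (u ∷ v ∷ vs)

  data StartsEnds : Fin n → Fin n → List (Fin n) → Set where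
    se-1 : ∀ v → StartsEnds v v (v ∷ [])
    se-∷ : ∀ {u w v vs} → StartsEnds w v (w ∷ vs) → StartsEnds u v (u ∷ w ∷ vs)

  IsPath : Fin n → Fin n → List (Fin n) → Set
  IsPath u v vs = StartsEnds u v vs × Chain vs × Unique vs

  Connected : Set
  Connected = ∀ u v → ∃[ vs ] IsPath u v vs

  HasCycle : Set
  HasCycle = ∃[ u ] ∃[ v ] ∃[ vs ] (IsPath u v vs × length vs ≥ 3 × Adj G v u)

  IsTree : Set
  IsTree = ∃[ k ] (n ≡ suc k) × Connected × ¬ HasCycle

  InNS : Fin n → Subset n → Fin n → Set
  InNS v S w = Adj G v w × w ∈ S

  InNS[] : Fin n → Subset n → Fin n → Set
  InNS[] v S w = (w ≡ v ⊎ Adj G v w) × w ∈ S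

  TwoInClosedNbhd : Fin n → Subset n → Set
  TwoInClosedNbhd v S = ∃[ a ] ∃[ b ] (¬ a ≡ b × InNS[] v S a × InNS[] v S b)

  IsLD : Subset n → Set
  IsLD S = (∀ v → v ∉ S → ∃[ w ] InNS v S w)
         × (∀ u v → u ∉ S → v ∉ S → ¬ u ≡ v →
              ¬ (∀ w → InNS v S w ⇔ InNS u S w))

  IsREDLD : Subset n → Set
  IsREDLD S = IsLD S × (∀ v → v ∈ S → IsLD (S ─ ⁅ v ⁆))

{-# OPTIONS --safe #-}
-- A tree has no cycles of length 3 or 4, so two distinct vertices have at most
-- one common neighbour, and two distinct vertices of a closed neighbourhood N[v]
-- have no common neighbour besides v. Hence a vertex with two neighbours in a set
-- is distinguished from every other vertex by its trace on that set. Every vertex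
-- outside S has two neighbours in S, which makes S locating-dominating. Outside
-- S - v, every vertex either still has two neighbours in S - v, or lies in N[v]
-- and has one; two vertices of the second kind sharing their trace would have a
-- common neighbour other than v.
module Submission where

open import Defs
open import Data.Nat using (ℕ; s≤s; z≤n)
open import Data.Fin using (Fin; _≟_)
open import Data.Fin.Subset using (Subset; _∈_; _∉_; _─_; _-_; inside; outside)
open import Data.Fin.Subset.Properties using (x∈p∧x≢y⇒x∈p-y; x∉⁅y⁆⇒x≢y)
open import Data.Vec.Base using (_∷_; here; there)
open import Data.List using ([]; _∷_)
open import Data.List.Relation.Unary.All using ([]; _∷_)
open import Data.List.Relation.Unary.AllPairs using ([]; _∷_)
open import Data.Product using (∃-syntax; _×_; _,_; proj₁)
open import Data.Sum using (_⊎_; inj₁; inj₂)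
open import Data.Empty using (⊥-elim)
open import Function using (_∘_)
open import Function.Bundles using (Equivalence; _⇔_)
open import Relation.Nullary using (¬_; yes; no; contradiction)
open import Relation.Unary using (_⊆_)
open import Relation.Binary.PropositionalEquality using (_≡_; _≢_; refl; ≢-sym)

x∈p─q⇒x∉q : ∀ {n} {p q : Subset n} {x} → x ∈ p ─ q → x ∉ q
x∈p─q⇒x∉q {p = inside ∷ _} {outside ∷ _} here       ()
x∈p─q⇒x∉q {p = _ ∷ _}      {_ ∷ _}       (there x∈) (there x∈q) = x∈p─q⇒x∉q x∈ x∈q

x∈p-y⇒x≢y : ∀ {n} {p : Subset n} {x y} → x ∈ p - y → x ≢ y
x∈p-y⇒x≢y = x∉⁅y⁆⇒x≢y ∘ x∈p─q⇒x∉q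

module _ {n : ℕ} (G : SimpleGraph n) where

  InClosedNbhd : Fin n → Fin n → Set
  InClosedNbhd v x = x ≡ v ⊎ Adj G v x

  TwoNeighboursIn : Subset n → Fin n → Set
  TwoNeighboursIn S x = ∃[ a ] ∃[ b ] (a ≢ b × InNS G x S a × InNS G x S b)

  adj⇒≢ : ∀ {a b} → Adj G a b → a ≢ b
  adj⇒≢ {a} a~b refl = irrefl G a a~b

  triangle⇒HasCycle : ∀ {a b c} → Adj G a b → Adj G b c → Adj G c a → HasCycle G
  triangle⇒HasCycle {a} {b} {c} a~b b~c c~a =
    a , c , (a ∷ b ∷ c ∷ [])
    , ( se-∷ (se-∷ (se-1 c))
      , chain-∷ a~b (chain-∷ b~c (chain-1 c))
      , (adj⇒≢ a~b ∷ ≢-sym (adj⇒≢ c~a) ∷ []) ∷ (adj⇒≢ b~c ∷ []) ∷ [] ∷ [])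
    , s≤s (s≤s (s≤s z≤n)) , c~a

  square⇒HasCycle : ∀ {a b c d} → Adj G a b → Adj G b c → Adj G c d → Adj G d a →
                    a ≢ c → b ≢ d → HasCycle G
  square⇒HasCycle {a} {b} {c} {d} a~b b~c c~d d~a a≢c b≢d =
    a , d , (a ∷ b ∷ c ∷ d ∷ [])
    , ( se-∷ (se-∷ (se-∷ (se-1 d)))
      , chain-∷ a~b (chain-∷ b~c (chain-∷ c~d (chain-1 d)))
      , (adj⇒≢ a~b ∷ a≢c ∷ ≢-sym (adj⇒≢ d~a) ∷ [])
        ∷ (adj⇒≢ b~c ∷ b≢d ∷ []) ∷ (adj⇒≢ c~d ∷ []) ∷ [] ∷ [])
    , s≤s (s≤s (s≤s z≤n)) , d~a

  twoInClosedNbhd⇒neighbourIn : ∀ {x S} → TwoInClosedNbhd G x S → ∃[ a ] InNS G x S a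
  twoInClosedNbhd⇒neighbourIn (a , b , a≢b , (inj₁ refl , _) , (inj₁ refl , _)) =
    contradiction refl a≢b
  twoInClosedNbhd⇒neighbourIn (a , b , _ , (inj₁ _ , _) , (inj₂ x~b , b∈S)) = b , x~b , b∈S
  twoInClosedNbhd⇒neighbourIn (a , b , _ , (inj₂ x~a , a∈S) , _) = a , x~a , a∈S

  twoInClosedNbhd⇒twoNeighboursIn : ∀ {x S} → TwoInClosedNbhd G x S → x ∉ S →
                                    TwoNeighboursIn S x
  twoInClosedNbhd⇒twoNeighboursIn (_ , _ , _ , (inj₁ refl , a∈S) , _) x∉S = contradiction a∈S x∉S
  twoInClosedNbhd⇒twoNeighboursIn (_ , _ , _ , _ , (inj₁ refl , b∈S)) x∉S = contradiction b∈S x∉S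
  twoInClosedNbhd⇒twoNeighboursIn (a , b , a≢b , (inj₂ x~a , a∈S) , (inj₂ x~b , b∈S)) _ =
    a , b , a≢b , (x~a , a∈S) , (x~b , b∈S)

  module Acyclic (acyclic : ¬ HasCycle G) where

    commonNeighbour-unique : ∀ {x y a b} → x ≢ y →
      Adj G x a → Adj G y a → Adj G x b → Adj G y b → a ≡ b
    commonNeighbour-unique {a = a} {b} x≢y x~a y~a x~b y~b with a ≟ b
    ... | yes a≡b = a≡b
    ... | no  a≢b = ⊥-elim (acyclic (square⇒HasCycle x~a (sym G y~a) y~b (sym G x~b) x≢y a≢b))

    commonNeighbour-closedNbhd : ∀ {v x y a} → x ≢ y → InClosedNbhd v x → InClosedNbhd v y →
      Adj G x a → Adj G y a → a ≡ v
    commonNeighbour-closedNbhd x≢y (inj₁ refl) (inj₁ refl) _ _ = contradiction refl x≢y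
    commonNeighbour-closedNbhd x≢y (inj₁ refl) (inj₂ v~y) v~a y~a =
      ⊥-elim (acyclic (triangle⇒HasCycle v~a (sym G y~a) (sym G v~y)))
    commonNeighbour-closedNbhd x≢y (inj₂ v~x) (inj₁ refl) x~v v~a =
      ⊥-elim (acyclic (triangle⇒HasCycle v~a (sym G x~v) (sym G v~x)))
    commonNeighbour-closedNbhd x≢y (inj₂ v~x) (inj₂ v~y) x~a y~a =
      commonNeighbour-unique x≢y x~a y~a (sym G v~x) (sym G v~y)

    twoNeighboursIn⇒⊈ : ∀ {S x y} → TwoNeighboursIn S x → x ≢ y → ¬ (InNS G x S ⊆ InNS G y S)
    twoNeighboursIn⇒⊈ (a , b , a≢b , x∈a@(x~a , _) , x∈b@(x~b , _)) x≢y x⊆y =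
      a≢b (commonNeighbour-unique x≢y x~a (proj₁ (x⊆y x∈a)) x~b (proj₁ (x⊆y x∈b)))

    twoNeighboursOutside⇒IsLD : ∀ {S} → (∀ x → x ∉ S → TwoNeighboursIn S x) → IsLD G S
    twoNeighboursOutside⇒IsLD two =
        (λ x x∉S → let a , _ , _ , x~a , _ = two x x∉S in a , x~a)
      , λ u v u∉S _ u≢v same → twoNeighboursIn⇒⊈ (two u u∉S) u≢v (Equivalence.from (same _))

    module WithoutVertex {S : Subset n} (two : ∀ x → TwoInClosedNbhd G x S) (v : Fin n) where

      ∉S-v⇒twoNeighbours⊎inN[v] : ∀ {x} → x ∉ S - v → TwoNeighboursIn (S - v) x ⊎
                                  (InClosedNbhd v x × ∃[ a ] InNS G x (S - v) a)
      ∉S-v⇒twoNeighbours⊎inN[v] {x} x∉S' with x ≟ v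
      ... | yes refl =
        let a , v~a , a∈S = twoInClosedNbhd⇒neighbourIn (two v)
        in inj₂ (inj₁ refl , a , v~a , x∈p∧x≢y⇒x∈p-y a∈S (≢-sym (adj⇒≢ v~a)))
      ... | no x≢v
        with a , b , a≢b , (x~a , a∈S) , (x~b , b∈S)
               ← twoInClosedNbhd⇒twoNeighboursIn (two x) (λ x∈S → x∉S' (x∈p∧x≢y⇒x∈p-y x∈S x≢v))
        with a ≟ v | b ≟ v
      ... | yes refl | yes refl = contradiction refl a≢b
      ... | yes refl | no b≢v   = inj₂ (inj₂ (sym G x~a) , b , x~b , x∈p∧x≢y⇒x∈p-y b∈S b≢v)
      ... | no a≢v   | yes refl = inj₂ (inj₂ (sym G x~b) , a , x~a , x∈p∧x≢y⇒x∈p-y a∈S a≢v)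
      ... | no a≢v   | no b≢v   =
        inj₁ (a , b , a≢b , (x~a , x∈p∧x≢y⇒x∈p-y a∈S a≢v) , (x~b , x∈p∧x≢y⇒x∈p-y b∈S b≢v))

      isLD : IsLD G (S - v)
      isLD = dominating , locating
        where
        dominating : ∀ x → x ∉ S - v → ∃[ a ] InNS G x (S - v) a
        dominating x x∉S' with ∉S-v⇒twoNeighbours⊎inN[v] x∉S'
        ... | inj₁ (a , _ , _ , x∈a , _) = a , x∈a
        ... | inj₂ (_ , x∈a)             = x∈a

        locating : ∀ x y → x ∉ S - v → y ∉ S - v → x ≢ y →
                   ¬ (∀ w → InNS G y (S - v) w ⇔ InNS G x (S - v) w)
        locating x y x∉S' y∉S' x≢y same with ∉S-v⇒twoNeighbours⊎inN[v] x∉S' | ∉S-v⇒twoNeighbours⊎inN[v] y∉S'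
        ... | inj₁ two-x | _ = twoNeighboursIn⇒⊈ two-x x≢y (Equivalence.from (same _))
        ... | _ | inj₁ two-y = twoNeighboursIn⇒⊈ two-y (≢-sym x≢y) (Equivalence.to (same _))
        ... | inj₂ (x≈v , a , x~a , a∈S') | inj₂ (y≈v , _) =
          x∈p-y⇒x≢y a∈S'
            (commonNeighbour-closedNbhd x≢y x≈v y≈v x~a (proj₁ (Equivalence.from (same a) (x~a , a∈S'))))

proposition2 : ∀ {n} (T : SimpleGraph n) → IsTree T → (S : Subset n) →
                 (∀ v → TwoInClosedNbhd T v S) → IsREDLD T S
proposition2 T (_ , _ , _ , acyclic) S two =
    twoNeighboursOutside⇒IsLD (λ x → twoInClosedNbhd⇒twoNeighboursIn T (two x))
  , λ v _ → WithoutVertex.isLD two v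
  where open Acyclic T acyclic
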